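{- Let $k\ge 1$ be an integer and let $p$ be a prime. (1) If $p=2$, then $p$ is a $k$-Wall-Sun-Sun prime if and only if $k\equiv 0\pmod 4$. (2) If $p\ge 3$ and $k\equiv 0\pmod{p^2}$, then $p$ is a $k$-Wall-Sun-Sun prime.
   Context: For a positive integer $k$, let $(U_n)_{n\ge0}$ be the sequence with $U_0=0$, $U_1=1$, $U_n=kU_{n-1}+U_{n-2}$ for $n\ge2$. For a prime $p$, $\pi_k(p)$ denotes the length of the period of $(U_n)$ modulo $p$. A prime $p$ is a $k$-Wall-Sun-Sun prime if $U_{\pi_k(p)}\equiv 0\pmod{p^2}$. -}

module Defs where

open import Data.Nat using (ℕ; zero; suc; _+_; _*_; _<_; _^_; NonZero)
open import Data.Nat.DivMod using (_%_)
open import Data.Nat.Divisibility using (_∣_)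
open import Data.Nat.Primality using (Prime)
open import Data.Product using (Σ; _×_)
open import Data.Empty using (⊥)
open import Relation.Binary.PropositionalEquality using (_≡_)

U : ℕ → ℕ → ℕ
U k zero = 0
U k (suc zero) = 1
U k (suc (suc n)) = k * U k (suc n) + U k n

-- (U_n mod p) is purely periodic with period n:  U_n ≡ U_0 and U_{n+1} ≡ U_1 (mod p)
-- (equivalent to U_{m+n} ≡ U_m (mod p) for all m, since the recurrence is order 2).
IsPeriodOf : (k p n : ℕ) → .{{NonZero p}} → Set
IsPeriodOf k p n = (U k n % p ≡ 0 % p) × (U k (suc n) % p ≡ 1 % p)

IsPi : (k p π : ℕ) → .{{NonZero p}} → Set
IsPi k p π = (0 < π) × IsPeriodOf k p π × (∀ m → 0 < m → m < π → IsPeriodOf k p m → ⊥)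

WallSunSun : (k p : ℕ) → .{{NonZero p}} → Set
WallSunSun k p = Σ ℕ λ π → IsPi k p π × (p ^ 2 ∣ U k π)

-- Modulo any d, U k n depends only on k mod d.  If p ∣ k (p > 1) then U k ≡ U 0 = 0,1,0,1,…
-- (mod p), so π_k(p) = 2 and, as U_2 = k, p is k-Wall-Sun-Sun iff p² ∣ k.  For odd k,
-- U k ≡ U 1 = 0,1,1,0,1,… (mod 2), so π_k(2) = 3, while U_3 = k² + 1 is never divisible by 4.
module Submission where

open import Defs
open import Data.Nat using (ℕ; zero; suc; _+_; _*_; _<_; _≤_; _≥_; _^_; _%_; s≤s; z≤n; NonZero)
open import Data.Nat.Properties using (<-cmp; <⇒≤; *-identityʳ; +-identityʳ)
open import Data.Nat.DivMod using (%-distribˡ-+; %-distribˡ-*; m%n%n≡m%n; m%n<n; m<n⇒m%n≡m)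
open import Data.Nat.Divisibility using (_∣_; _∣0; ∣-trans; m∣m*n; m%n≡0⇒n∣m; n∣m⇒m%n≡0)
open import Data.Nat.Primality using (Prime; prime⇒nonZero)
open import Data.Product using (_×_; _,_)
open import Data.Empty using (⊥; ⊥-elim)
open import Function using (_∘_)
open import Function.Bundles using (_⇔_; mk⇔; Equivalence)
open import Relation.Binary.PropositionalEquality using (_≡_; _≢_; refl; sym; trans; cong₂; subst)
open import Relation.Binary.Definitions using (tri<; tri≈; tri>)
open import Relation.Nullary using (¬_)

module _ (d : ℕ) .{{_ : NonZero d}} where

  %-cong-+ : ∀ {a a′ b b′} → a % d ≡ a′ % d → b % d ≡ b′ % d → (a + b) % d ≡ (a′ + b′) % d
  %-cong-+ {a} {a′} {b} {b′} a≡a′ b≡b′ =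
    trans (%-distribˡ-+ a b d)
      (trans (cong₂ (λ x y → (x + y) % d) a≡a′ b≡b′) (sym (%-distribˡ-+ a′ b′ d)))

  %-cong-* : ∀ {a a′ b b′} → a % d ≡ a′ % d → b % d ≡ b′ % d → (a * b) % d ≡ (a′ * b′) % d
  %-cong-* {a} {a′} {b} {b′} a≡a′ b≡b′ =
    trans (%-distribˡ-* a b d)
      (trans (cong₂ (λ x y → (x * y) % d) a≡a′ b≡b′) (sym (%-distribˡ-* a′ b′ d)))

  U-cong-% : ∀ {k k′} → k % d ≡ k′ % d → ∀ n → U k n % d ≡ U k′ n % d
  U-cong-% k≡k′ zero = refl
  U-cong-% k≡k′ (suc zero) = refl
  U-cong-% k≡k′ (suc (suc n)) =
    %-cong-+ (%-cong-* k≡k′ (U-cong-% k≡k′ (suc n))) (U-cong-% k≡k′ n)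

U-2 : ∀ k → U k 2 ≡ k
U-2 k = trans (+-identityʳ (k * 1)) (*-identityʳ k)

4∤U-3 : ∀ k → ¬ 4 ∣ U k 3
4∤U-3 k 4∣U₃ = residue (k % 4) (m%n<n k 4)
  (trans (sym (U-cong-% 4 {k} {k % 4} (sym (m%n%n≡m%n k 4)) 3)) (n∣m⇒m%n≡0 _ 4 4∣U₃))
  where
  residue : ∀ r → r < 4 → U r 3 % 4 ≢ 0
  residue 0 _ ()
  residue 1 _ ()
  residue 2 _ ()
  residue 3 _ ()
  residue (suc (suc (suc (suc _)))) (s≤s (s≤s (s≤s (s≤s ())))) _

module _ {p : ℕ} .{{_ : NonZero p}} where

  IsPeriodOf-cong : ∀ {k k′ π} → (∀ n → U k n % p ≡ U k′ n % p) →
                    IsPeriodOf k p π → IsPeriodOf k′ p π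
  IsPeriodOf-cong {π = π} k≈k′ (U₀ , U₁) = trans (sym (k≈k′ π)) U₀ , trans (sym (k≈k′ (suc π))) U₁

  IsPi-cong : ∀ {k k′ π} → (∀ n → U k n % p ≡ U k′ n % p) → IsPi k p π → IsPi k′ p π
  IsPi-cong {π = π} k≈k′ (0<π , period , least) =
    0<π , IsPeriodOf-cong {π = π} k≈k′ period ,
    λ m 0<m m<π → least m 0<m m<π ∘ IsPeriodOf-cong {π = m} (λ n → sym (k≈k′ n))

  IsPi-unique : ∀ {k a b} → IsPi k p a → IsPi k p b → a ≡ b
  IsPi-unique {a = a} {b} (0<a , period-a , least-a) (0<b , period-b , least-b) with <-cmp a b
  ... | tri< a<b _ _ = ⊥-elim (least-b a 0<a a<b period-a)
  ... | tri≈ _ a≡b _ = a≡b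
  ... | tri> _ _ b<a = ⊥-elim (least-a b 0<b b<a period-b)

  WallSunSun⇔ : ∀ {k π} → IsPi k p π → WallSunSun k p ⇔ (p ^ 2 ∣ U k π)
  WallSunSun⇔ {k} {π} isPi = mk⇔
    (λ (π′ , isPi′ , p²∣U) → subst (λ m → p ^ 2 ∣ U k m) (IsPi-unique isPi′ isPi) p²∣U)
    (λ p²∣U → π , isPi , p²∣U)

  IsPi-0 : 1 < p → IsPi 0 p 2
  IsPi-0 1<p = s≤s z≤n , (refl , refl) , least
    where
    least : ∀ m → 0 < m → m < 2 → IsPeriodOf 0 p m → ⊥
    least 1 _ _ (U₁≡0 , _) with trans (sym (m<n⇒m%n≡m 1<p)) (trans U₁≡0 (m<n⇒m%n≡m (<⇒≤ 1<p)))
    ... | ()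
    least (suc (suc _)) _ (s≤s (s≤s ())) _

  IsPi-multiple : ∀ {k} → p ∣ k → 1 < p → IsPi k p 2
  IsPi-multiple {k} p∣k 1<p =
    IsPi-cong (U-cong-% p (trans (n∣m⇒m%n≡0 0 p (p ∣0)) (sym (n∣m⇒m%n≡0 k p p∣k)))) (IsPi-0 1<p)

  WallSunSun⇔-multiple : ∀ {k} → p ∣ k → 1 < p → WallSunSun k p ⇔ (p ^ 2 ∣ k)
  WallSunSun⇔-multiple {k} p∣k 1<p =
    subst (λ x → WallSunSun k p ⇔ (p ^ 2 ∣ x)) (U-2 k) (WallSunSun⇔ (IsPi-multiple p∣k 1<p))

IsPi-1-2 : IsPi 1 2 3
IsPi-1-2 = s≤s z≤n , (refl , refl) , least
  where
  least : ∀ m → 0 < m → m < 3 → IsPeriodOf 1 2 m → ⊥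
  least 1 _ _ (() , _)
  least 2 _ _ (() , _)
  least (suc (suc (suc _))) _ (s≤s (s≤s (s≤s ()))) _

module _ {k : ℕ} (k-odd : k % 2 ≡ 1) where

  IsPi-odd-2 : IsPi k 2 3
  IsPi-odd-2 = IsPi-cong (U-cong-% 2 (sym k-odd)) IsPi-1-2

  odd⇒¬WallSunSun-2 : ¬ WallSunSun k 2
  odd⇒¬WallSunSun-2 wss = 4∤U-3 k (Equivalence.to (WallSunSun⇔ IsPi-odd-2) wss)

  odd⇒4∤ : ¬ 4 ∣ k
  odd⇒4∤ 4∣k with trans (sym k-odd) (n∣m⇒m%n≡0 k 2 (∣-trans (m∣m*n 2) 4∣k))
  ... | ()

WallSunSun-2⇔ : ∀ k → WallSunSun k 2 ⇔ (4 ∣ k)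
WallSunSun-2⇔ k with k % 2 in parity | m%n<n k 2
... | 0 | _ = WallSunSun⇔-multiple (m%n≡0⇒n∣m k 2 parity) (s≤s (s≤s z≤n))
... | 1 | _ = mk⇔ (⊥-elim ∘ odd⇒¬WallSunSun-2 parity) (⊥-elim ∘ odd⇒4∤ parity)
... | suc (suc _) | s≤s (s≤s ())

lemma3p3 : (k p : ℕ) → 1 ≤ k → (pr : Prime p) →
    ((p ≡ 2 → (WallSunSun k 2 ⇔ (4 ∣ k)))
    × (p ≥ 3 → p ^ 2 ∣ k → WallSunSun k p {{prime⇒nonZero pr}}))
lemma3p3 k p _ pr = (λ _ → WallSunSun-2⇔ k) , odd-prime
  where
  instance _ = prime⇒nonZero pr
  odd-prime : p ≥ 3 → p ^ 2 ∣ k → WallSunSun k p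
  odd-prime p≥3 p²∣k =
    Equivalence.from (WallSunSun⇔-multiple (∣-trans (m∣m*n (p ^ 1)) p²∣k) (<⇒≤ p≥3)) p²∣k
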